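{- Let $\Gamma$ be a finite linear space such that the triangle complex $\Delta(\Gamma)$ is flag-transitive. Then every line of $\Gamma$ is incident with the same number of points, and every point of $\Gamma$ is incident with the same number of lines.
   Context: A linear space is a rank two geometry of points and lines in which every line has at least two points, every point is on at least two lines, and any two distinct points lie on exactly one common line. Triangle complex: $\Delta(\Gamma)$ is the rank three incidence system over $\{1,2,3\}$ whose elements are the triples $(p,L,i)$ with $p$ incident with $L$ and $i\in\{1,2,3\}$; the type of $(p,L,i)$ is $i$; and $(p,L,i)$ is incident with $(p',L',i \bmod 3+1)$ if and only if the set of points incident with both $L$ and $L'$ is exactly $\{p\}$ and $p\neq p'$ (incidence symmetric and reflexive, no other incidences). Flag-transitive means the group of type-preserving incidence-preserving bijections is transitive on chambers (triples of pairwise incident elements of types $1,2,3$). -}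

module Defs where

open import Data.Nat using (ℕ)
open import Data.Fin using (Fin; zero; suc)
open import Data.Bool using (Bool; true)
open import Data.List using (length; filterᵇ; allFin)
open import Data.Product using (Σ; ∃; ∃-syntax; _×_; _,_)
open import Data.Sum using (_⊎_)
open import Relation.Binary.PropositionalEquality using (_≡_; _≢_)
open import Function.Bundles using (Bijection; _⤖_)

record FiniteGeometry : Set where
  field
    m n : ℕ
    I   : Fin m → Fin n → Bool

module _ (Γ : FiniteGeometry) where
  open FiniteGeometry Γ

  Inc : Fin m → Fin n → Set
  Inc p L = I p L ≡ true

  record IsLinearSpace : Set where
    field
      line-two-points : ∀ L → ∃[ p ] ∃[ q ] (p ≢ q × Inc p L × Inc q L)
      point-two-lines : ∀ p → ∃[ L ] ∃[ L' ] (L ≢ L' × Inc p L × Inc p L')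
      unique-line     : ∀ p q → p ≢ q →
                          ∃[ L ] ((Inc p L × Inc q L) ×
                                  (∀ L' → Inc p L' → Inc q L' → L' ≡ L))

  pointsOn : Fin n → ℕ
  pointsOn L = length (filterᵇ (λ p → I p L) (allFin m))

  linesThrough : Fin m → ℕ
  linesThrough p = length (filterᵇ (λ L → I p L) (allFin n))

  -- Triangle complex Δ(Γ); types {1,2,3} are encoded as Fin 3 = {0,1,2}
  record Elem : Set where
    constructor elem
    field
      pt  : Fin m
      ln  : Fin n
      typ : Fin 3
      inc : Inc pt ln

  open Elem public

  next : Fin 3 → Fin 3
  next zero = suc zero
  next (suc zero) = suc (suc zero)
  next (suc (suc zero)) = zero

  DirInc : Elem → Elem → Set
  DirInc x y = next (typ x) ≡ typ y
             × Inc (pt x) (ln y)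
             × (∀ q → Inc q (ln x) → Inc q (ln y) → q ≡ pt x)
             × pt x ≢ pt y

  _*_ : Elem → Elem → Set
  x * y = x ≡ y ⊎ DirInc x y ⊎ DirInc y x

  record Chamber : Set where
    constructor chamber
    field
      c₁ c₂ c₃ : Elem
      t₁ : typ c₁ ≡ zero
      t₂ : typ c₂ ≡ suc zero
      t₃ : typ c₃ ≡ suc (suc zero)
      i₁₂ : c₁ * c₂
      i₂₃ : c₂ * c₃
      i₁₃ : c₁ * c₃

  record Automorphism : Set where
    field
      bij : Elem ⤖ Elem
    f : Elem → Elem
    f = Bijection.to bij
    field
      type-pres : ∀ x → typ (f x) ≡ typ x
      inc-pres  : ∀ x y → (x * y → f x * f y) × (f x * f y → x * y)

  FlagTransitive : Set
  FlagTransitive = ∀ (C D : Chamber) → ∃[ φ ]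
    (Automorphism.f φ (Chamber.c₁ C) ≡ Chamber.c₁ D
     × Automorphism.f φ (Chamber.c₂ C) ≡ Chamber.c₂ D
     × Automorphism.f φ (Chamber.c₃ C) ≡ Chamber.c₃ D)

-- The three elements (pᵢ, Lᵢ, i) of a chamber form a triangle: Lᵢ joins pᵢ to the
-- previous point, and every line is the side L₃ of some chamber.  The type-2 elements
-- incident with both (p₁, L₁, 1) and (p₃, L₃, 3) are exactly the (q, p₁q) with
-- q ∈ L₃ ∖ {p₃}, so an automorphism carrying one chamber to another maps the points of
-- one L₃ injectively to those of the other; hence every line has the same number
-- k ≥ 2 of points.  Counting the pairs (L, q) with p, q ∈ L, where q = p occurs once per
-- line through p and each q ≠ p once in total, gives r·k + 1 = r + m for the number r
-- of lines through p, which determines r.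
module Submission where

open import Defs
open import Data.Nat using (ℕ)
open import Data.Product using (∃-syntax; _×_)
open import Relation.Binary.PropositionalEquality using (_≡_)

import Data.Nat as ℕ
import Data.Nat.Properties as ℕ
open import Data.Bool using (Bool; true; false)
import Data.Bool.Properties as Bool
open import Data.Empty using (⊥-elim)
open import Data.Fin using (Fin; zero; suc; _≟_)
open import Data.Fin.Permutation using (↔⇒≡)
open import Data.Fin.Properties using (+↔⊎; *↔×; 1↔⊤; injective⇒≤; cantor-schröder-bernstein)
open import Data.List using (length; filterᵇ; tabulate; allFin)
open import Data.Product using (Σ; _,_; proj₁; proj₂)
open import Data.Product.Function.Dependent.Propositional using (Σ-↔)
open import Data.Sum using (_⊎_; inj₁; inj₂)
open import Data.Sum.Function.Propositional using (_⊎-↔_)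
open import Data.Unit using (⊤; tt)
open import Function using (_∘_; id; _↔_; _↣_; mk↔ₛ′; mk↣; Injective; Injection; Bijection)
open import Function.Properties.Inverse using (↔-refl; ↔-sym; ↔⇒↣)
open import Function.Construct.Composition using (_↣-∘_; _↔-∘_)
open import Function.Related.Propositional using (module EquationalReasoning)
open import Axiom.UniquenessOfIdentityProofs using (module Decidable⇒UIP)
open import Relation.Binary.PropositionalEquality
  using (_≢_; refl; sym; trans; cong; cong₂; subst; ≢-sym; module ≡-Reasoning)
open import Relation.Nullary using (¬_; Dec; yes; no; Irrelevant)
open import Relation.Nullary.Decidable using (decidable-stable; dec-no; dec-yes-irr)

Satisfying : {A : Set} → (A → Bool) → Set
Satisfying {A} b = Σ A (λ x → b x ≡ true)

≡true-irrelevant : {b : Bool} → Irrelevant (b ≡ true)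
≡true-irrelevant = Decidable⇒UIP.≡-irrelevant Bool._≟_

Fin-≡-irrelevant : {m : ℕ} {i j : Fin m} → Irrelevant (i ≡ j)
Fin-≡-irrelevant = Decidable⇒UIP.≡-irrelevant _≟_

satisfying-≡ : {A : Set} {b : A → Bool} {s t : Satisfying b} → proj₁ s ≡ proj₁ t → s ≡ t
satisfying-≡ {s = x , bx} {t = .x , bx′} refl = cong (x ,_) (≡true-irrelevant bx bx′)

Σ-Fin-suc-↔ : {m : ℕ} {P : Fin (ℕ.suc m) → Set} → Σ (Fin (ℕ.suc m)) P ↔ (P zero ⊎ Σ (Fin m) (P ∘ suc))
Σ-Fin-suc-↔ = mk↔ₛ′
  (λ { (zero , p) → inj₁ p ; (suc i , p) → inj₂ (i , p) })
  (λ { (inj₁ p) → zero , p ; (inj₂ (i , p)) → suc i , p })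
  (λ { (inj₁ _) → refl ; (inj₂ _) → refl })
  (λ { (zero , _) → refl ; (suc _ , _) → refl })

filterᵇ-tabulate-↔ : {A : Set} {m : ℕ} (f : Fin m → A) (b : A → Bool) →
  Fin (length (filterᵇ b (tabulate f))) ↔ Satisfying (b ∘ f)
filterᵇ-tabulate-↔ {m = ℕ.zero} f b = mk↔ₛ′ (λ ()) (λ ()) (λ ()) (λ ())
filterᵇ-tabulate-↔ {m = ℕ.suc m} f b with b (f zero) in bf₀
... | true  = begin
    Fin (ℕ.suc _)                            ↔⟨ +↔⊎ {1} ⟩
    (Fin 1 ⊎ Fin _)                          ↔⟨ 1↔⊤ ⊎-↔ filterᵇ-tabulate-↔ (f ∘ suc) b ⟩
    (⊤ ⊎ Satisfying (b ∘ f ∘ suc))           ↔⟨ ⊤↔bf₀ ⊎-↔ ↔-refl ⟩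
    ((b (f zero) ≡ true) ⊎ Satisfying (b ∘ f ∘ suc)) ↔⟨ ↔-sym Σ-Fin-suc-↔ ⟩
    Satisfying (b ∘ f)                       ∎
  where
  open EquationalReasoning
  ⊤↔bf₀ : ⊤ ↔ (b (f zero) ≡ true)
  ⊤↔bf₀ = mk↔ₛ′ (λ _ → bf₀) (λ _ → tt) (λ _ → ≡true-irrelevant _ _) (λ _ → refl)
... | false = mk↔ₛ′ shift unshift shift-unshift (λ _ → refl) ↔-∘ filterᵇ-tabulate-↔ (f ∘ suc) b
  where
  bf₀≢true : b (f zero) ≢ true
  bf₀≢true p with () ← trans (sym bf₀) p
  shift : Satisfying (b ∘ f ∘ suc) → Satisfying (b ∘ f)
  shift (i , p) = suc i , p
  unshift : Satisfying (b ∘ f) → Satisfying (b ∘ f ∘ suc)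
  unshift (zero , p) = ⊥-elim (bf₀≢true p)
  unshift (suc i , p) = i , p
  shift-unshift : ∀ s → shift (unshift s) ≡ s
  shift-unshift (zero , p) = ⊥-elim (bf₀≢true p)
  shift-unshift (suc i , p) = refl

filterᵇ-allFin-↔ : {m : ℕ} (b : Fin m → Bool) → Fin (length (filterᵇ b (allFin m))) ↔ Satisfying b
filterᵇ-allFin-↔ = filterᵇ-tabulate-↔ id

filterᵇ-allFin-↣ : {m m′ : ℕ} {b : Fin m → Bool} {b′ : Fin m′ → Bool} → Satisfying b ↣ Satisfying b′ →
  Fin (length (filterᵇ b (allFin m))) ↣ Fin (length (filterᵇ b′ (allFin m′)))
filterᵇ-allFin-↣ {b = b} {b′} f = ↔⇒↣ (↔-sym (filterᵇ-allFin-↔ b′)) ↣-∘ (f ↣-∘ ↔⇒↣ (filterᵇ-allFin-↔ b))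

length-filterᵇ-cantor-schröder-bernstein : {m m′ : ℕ} {b : Fin m → Bool} {b′ : Fin m′ → Bool} →
  Satisfying b ↣ Satisfying b′ → Satisfying b′ ↣ Satisfying b →
  length (filterᵇ b (allFin m)) ≡ length (filterᵇ b′ (allFin m′))
length-filterᵇ-cantor-schröder-bernstein f g = cantor-schröder-bernstein
  (Injection.injective (filterᵇ-allFin-↣ f)) (Injection.injective (filterᵇ-allFin-↣ g))

*k+1≡+m-unique : ∀ {k m a b} → 2 ℕ.≤ k → a ℕ.* k ℕ.+ 1 ≡ a ℕ.+ m → b ℕ.* k ℕ.+ 1 ≡ b ℕ.+ m → a ≡ b
*k+1≡+m-unique {ℕ.suc (ℕ.suc j)} {m} {a} {b} (ℕ.s≤s (ℕ.s≤s ℕ.z≤n)) a-eq b-eq =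
  ℕ.*-cancelʳ-≡ a b (ℕ.suc j) (ℕ.+-cancelʳ-≡ 1 _ _ (trans (cancel a a-eq) (sym (cancel b b-eq))))
  where
  open ≡-Reasoning
  cancel : ∀ x → x ℕ.* ℕ.suc (ℕ.suc j) ℕ.+ 1 ≡ x ℕ.+ m → x ℕ.* ℕ.suc j ℕ.+ 1 ≡ m
  cancel x eq = ℕ.+-cancelˡ-≡ x _ _ (begin
    x ℕ.+ (x ℕ.* ℕ.suc j ℕ.+ 1)   ≡⟨ ℕ.+-assoc x _ 1 ⟨
    x ℕ.+ x ℕ.* ℕ.suc j ℕ.+ 1     ≡⟨ cong (ℕ._+ 1) (ℕ.*-suc x (ℕ.suc j)) ⟨
    x ℕ.* ℕ.suc (ℕ.suc j) ℕ.+ 1   ≡⟨ eq ⟩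
    x ℕ.+ m                       ∎)

constant⇒∃ : ∀ {n} {f : Fin n → ℕ} → (∀ i j → f i ≡ f j) → ∃[ k ] (∀ i → f i ≡ k)
constant⇒∃ {ℕ.zero} _ = 0 , λ ()
constant⇒∃ {ℕ.suc _} {f} const = f zero , λ i → const i zero

module LinearSpace {Γ : FiniteGeometry} (LS : IsLinearSpace Γ) where
  open FiniteGeometry Γ
  open IsLinearSpace LS
  open Chamber

  PointsOn : Fin n → Set
  PointsOn L = Satisfying (λ q → I q L)

  LinesThrough : Fin m → Set
  LinesThrough p = Satisfying (λ L → I p L)

  line-unique : ∀ {p q L L′} → p ≢ q → Inc Γ p L → Inc Γ q L → Inc Γ p L′ → Inc Γ q L′ → L ≡ L′
  line-unique {p} {q} p≢q p∈L q∈L p∈L′ q∈L′ =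
    let (_ , _ , unique) = unique-line p q p≢q in trans (unique _ p∈L q∈L) (sym (unique _ p∈L′ q∈L′))

  join : ∀ {p q} → p ≢ q → Fin n
  join {p} {q} p≢q = proj₁ (unique-line p q p≢q)

  join-incˡ : ∀ {p q} (p≢q : p ≢ q) → Inc Γ p (join p≢q)
  join-incˡ {p} {q} p≢q = proj₁ (proj₁ (proj₂ (unique-line p q p≢q)))

  join-incʳ : ∀ {p q} (p≢q : p ≢ q) → Inc Γ q (join p≢q)
  join-incʳ {p} {q} p≢q = proj₂ (proj₁ (proj₂ (unique-line p q p≢q)))

  meet-unique : ∀ {p L L′} → L ≢ L′ → Inc Γ p L → Inc Γ p L′ → ∀ q → Inc Γ q L → Inc Γ q L′ → q ≡ p
  meet-unique L≢L′ p∈L p∈L′ q q∈L q∈L′ =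
    decidable-stable (q ≟ _) (λ q≢p → L≢L′ (line-unique q≢p q∈L p∈L q∈L′ p∈L′))

  line-∈∉⇒≢ : ∀ {p L L′} → Inc Γ p L → ¬ Inc Γ p L′ → L ≢ L′
  line-∈∉⇒≢ p∈L p∉L′ refl = p∉L′ p∈L

  point-∉∈⇒≢ : ∀ {p q L} → ¬ Inc Γ p L → Inc Γ q L → p ≢ q
  point-∉∈⇒≢ p∉L q∈L refl = p∉L q∈L

  other-point : ∀ L p → ∃[ q ] (Inc Γ q L × q ≢ p)
  other-point L p with line-two-points L
  ... | q , q′ , q≢q′ , q∈L , q′∈L with q ≟ p
  ...   | no q≢p = q , q∈L , q≢p
  ...   | yes refl = q′ , q′∈L , ≢-sym q≢q′

  other-line : ∀ p L → ∃[ M ] (Inc Γ p M × M ≢ L)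
  other-line p L with point-two-lines p
  ... | M , M′ , M≢M′ , p∈M , p∈M′ with M ≟ L
  ...   | no M≢L = M , p∈M , M≢L
  ...   | yes refl = M′ , p∈M′ , ≢-sym M≢M′

  elem-≡ : ∀ {x y : Elem Γ} → pt x ≡ pt y → ln x ≡ ln y → typ x ≡ typ y → x ≡ y
  elem-≡ {elem p L t p∈L} {elem .p .L .t p∈L′} refl refl refl = cong (elem p L t) (≡true-irrelevant p∈L p∈L′)

  next-irreflexive : ∀ t → next Γ t ≢ t
  next-irreflexive zero ()
  next-irreflexive (suc zero) ()
  next-irreflexive (suc (suc zero)) ()

  next²-irreflexive : ∀ t → next Γ (next Γ t) ≢ t
  next²-irreflexive zero ()
  next²-irreflexive (suc zero) ()
  next²-irreflexive (suc (suc zero)) ()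

  *-sym : ∀ {x y} → _*_ Γ x y → _*_ Γ y x
  *-sym (inj₁ x≡y) = inj₁ (sym x≡y)
  *-sym (inj₂ (inj₁ x→y)) = inj₂ (inj₂ x→y)
  *-sym (inj₂ (inj₂ y→x)) = inj₂ (inj₁ y→x)

  *⇒DirInc : ∀ {x y} → next Γ (typ x) ≡ typ y → _*_ Γ x y → DirInc Γ x y
  *⇒DirInc {x} t (inj₁ refl) = ⊥-elim (next-irreflexive (typ x) t)
  *⇒DirInc t (inj₂ (inj₁ x→y)) = x→y
  *⇒DirInc {x} t (inj₂ (inj₂ y→x)) = ⊥-elim (next²-irreflexive (typ x) (trans (cong (next Γ) t) (proj₁ y→x)))

  DirInc-intro : ∀ x y → next Γ (typ x) ≡ typ y → Inc Γ (pt x) (ln y) → ln x ≢ ln y → pt x ≢ pt y → DirInc Γ x y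
  DirInc-intro x _ t px∈Ly Lx≢Ly px≢py = t , px∈Ly , meet-unique Lx≢Ly (inc x) px∈Ly , px≢py

  Residue : Chamber Γ → Elem Γ → Set
  Residue C y = typ y ≡ suc zero × _*_ Γ (c₁ C) y × _*_ Γ y (c₃ C)

  module _ (C : Chamber Γ) where
    c₃→c₁ : DirInc Γ (c₃ C) (c₁ C)
    c₃→c₁ = *⇒DirInc (trans (cong (next Γ) (t₃ C)) (sym (t₁ C))) (*-sym (i₁₃ C))

    p₁∉L₃ : ¬ Inc Γ (pt (c₁ C)) (ln (c₃ C))
    p₁∉L₃ p₁∈L₃ = let (_ , _ , meet , p₃≢p₁) = c₃→c₁ in p₃≢p₁ (sym (meet _ p₁∈L₃ (inc (c₁ C))))

    residue-c₁→ : ∀ {y} → Residue C y → DirInc Γ (c₁ C) y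
    residue-c₁→ (t , c₁*y , _) = *⇒DirInc (trans (cong (next Γ) (t₁ C)) (sym t)) c₁*y

    residue-→c₃ : ∀ {y} → Residue C y → DirInc Γ y (c₃ C)
    residue-→c₃ (t , _ , y*c₃) = *⇒DirInc (trans (cong (next Γ) t) (sym (t₃ C))) y*c₃

    residue-point-on-line : ∀ {y} → Residue C y → Inc Γ (pt y) (ln (c₃ C))
    residue-point-on-line r = proj₁ (proj₂ (residue-→c₃ r))

    residue-point-≢ : ∀ {y} → Residue C y → pt y ≢ pt (c₃ C)
    residue-point-≢ r = proj₂ (proj₂ (proj₂ (residue-→c₃ r)))

    residue-determined-by-point : ∀ {y y′} → Residue C y → Residue C y′ → pt y ≡ pt y′ → y ≡ y′
    residue-determined-by-point {y} {y′} ry ry′ py≡py′ =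
      elem-≡ py≡py′ (line-unique p₁≢py (p₁∈ ry) (inc y) (p₁∈ ry′) (subst (λ q → Inc Γ q (ln y′)) (sym py≡py′) (inc y′)))
             (trans (proj₁ ry) (sym (proj₁ ry′)))
      where
      p₁∈ : ∀ {z} → Residue C z → Inc Γ (pt (c₁ C)) (ln z)
      p₁∈ rz = proj₁ (proj₂ (residue-c₁→ rz))
      p₁≢py : pt (c₁ C) ≢ pt y
      p₁≢py = proj₂ (proj₂ (proj₂ (residue-c₁→ ry)))

    residue-elem : ∀ {q} → Inc Γ q (ln (c₃ C)) → Elem Γ
    residue-elem {q} q∈L₃ = elem q (join (point-∉∈⇒≢ p₁∉L₃ q∈L₃)) (suc zero) (join-incʳ _)

    residue-elem-residue : ∀ {q} (q∈L₃ : Inc Γ q (ln (c₃ C))) → q ≢ pt (c₃ C) → Residue C (residue-elem q∈L₃)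
    residue-elem-residue {q} q∈L₃ q≢p₃ = refl
      , inj₂ (inj₁ (DirInc-intro (c₁ C) y (cong (next Γ) (t₁ C)) (join-incˡ _)
                      (≢-sym (line-∈∉⇒≢ (join-incʳ _) q∉L₁)) (point-∉∈⇒≢ p₁∉L₃ q∈L₃)))
      , inj₂ (inj₁ (DirInc-intro y (c₃ C) (sym (t₃ C)) q∈L₃ (line-∈∉⇒≢ (join-incˡ _) p₁∉L₃) q≢p₃))
      where
      y : Elem Γ
      y = residue-elem q∈L₃
      q∉L₁ : ¬ Inc Γ q (ln (c₁ C))
      q∉L₁ q∈L₁ = let (_ , _ , meet , _) = c₃→c₁ in q≢p₃ (meet q q∈L₃ q∈L₁)

  module _ (C D : Chamber Γ) (φ : Automorphism Γ)
           (φc₁ : Automorphism.f φ (c₁ C) ≡ c₁ D) (φc₃ : Automorphism.f φ (c₃ C) ≡ c₃ D) where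
    open Automorphism φ

    residue-preserved : ∀ {y} → Residue C y → Residue D (f y)
    residue-preserved {y} (t , c₁*y , y*c₃) = trans (type-pres y) t
      , subst (λ x → _*_ Γ x (f y)) φc₁ (proj₁ (inc-pres _ y) c₁*y)
      , subst (_*_ Γ (f y)) φc₃ (proj₁ (inc-pres y _) y*c₃)

    image-residue : ∀ {q} (q∈L₃ : Inc Γ q (ln (c₃ C))) → q ≢ pt (c₃ C) → Residue D (f (residue-elem C q∈L₃))
    image-residue q∈L₃ q≢p₃ = residue-preserved (residue-elem-residue C q∈L₃ q≢p₃)

    transfer : ∀ {q} → Inc Γ q (ln (c₃ C)) → Dec (q ≡ pt (c₃ C)) → Fin m
    transfer _ (yes _) = pt (c₃ D)
    transfer q∈L₃ (no _) = pt (f (residue-elem C q∈L₃))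

    transfer-on-line : ∀ {q} (q∈L₃ : Inc Γ q (ln (c₃ C))) d → Inc Γ (transfer q∈L₃ d) (ln (c₃ D))
    transfer-on-line _ (yes _) = inc (c₃ D)
    transfer-on-line q∈L₃ (no q≢p₃) = residue-point-on-line D (image-residue q∈L₃ q≢p₃)

    transfer-injective : ∀ {q q′} (q∈L₃ : Inc Γ q (ln (c₃ C))) (q′∈L₃ : Inc Γ q′ (ln (c₃ C))) d d′ →
                         transfer q∈L₃ d ≡ transfer q′∈L₃ d′ → q ≡ q′
    transfer-injective _ _ (yes q≡p₃) (yes q′≡p₃) _ = trans q≡p₃ (sym q′≡p₃)
    transfer-injective _ q′∈L₃ (yes _) (no q′≢p₃) e = ⊥-elim (residue-point-≢ D (image-residue q′∈L₃ q′≢p₃) (sym e))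
    transfer-injective q∈L₃ _ (no q≢p₃) (yes _) e = ⊥-elim (residue-point-≢ D (image-residue q∈L₃ q≢p₃) e)
    transfer-injective q∈L₃ q′∈L₃ (no q≢p₃) (no q′≢p₃) e = cong pt (Bijection.injective bij
      (residue-determined-by-point D (image-residue q∈L₃ q≢p₃) (image-residue q′∈L₃ q′≢p₃) e))

    points-transfer : PointsOn (ln (c₃ C)) ↣ PointsOn (ln (c₃ D))
    points-transfer = mk↣ {to = to} λ {(_ , q∈L₃)} {(_ , q′∈L₃)} e →
      satisfying-≡ (transfer-injective q∈L₃ q′∈L₃ (_ ≟ _) (_ ≟ _) (cong proj₁ e))
      where
      to : PointsOn (ln (c₃ C)) → PointsOn (ln (c₃ D))
      to (q , q∈L₃) = transfer q∈L₃ (q ≟ pt (c₃ C)) , transfer-on-line q∈L₃ (q ≟ pt (c₃ C))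

  pointsOn-chamber-≡ : FlagTransitive Γ → ∀ C D → pointsOn Γ (ln (c₃ C)) ≡ pointsOn Γ (ln (c₃ D))
  pointsOn-chamber-≡ FT C D =
    let (φ , φc₁ , _ , φc₃) = FT C D
        (ψ , ψc₁ , _ , ψc₃) = FT D C
    in length-filterᵇ-cantor-schröder-bernstein (points-transfer C D φ φc₁ φc₃) (points-transfer D C ψ ψc₁ ψc₃)

  triangle-chamber : ∀ {p₁ p₂ p₃ L M} → p₂ ≢ p₃ → Inc Γ p₂ L → Inc Γ p₃ L →
                     Inc Γ p₃ M → M ≢ L → Inc Γ p₁ M → p₁ ≢ p₃ → Chamber Γ
  triangle-chamber {p₁} {p₂} {p₃} {L} {M} p₂≢p₃ p₂∈L p₃∈L p₃∈M M≢L p₁∈M p₁≢p₃ = record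
    { c₁ = x₁ ; c₂ = x₂ ; c₃ = x₃ ; t₁ = refl ; t₂ = refl ; t₃ = refl
    ; i₁₂ = inj₂ (inj₁ (DirInc-intro x₁ x₂ refl (join-incˡ p₁≢p₂) M≢N p₁≢p₂))
    ; i₂₃ = inj₂ (inj₁ (DirInc-intro x₂ x₃ refl p₂∈L N≢L p₂≢p₃))
    ; i₁₃ = inj₂ (inj₂ (DirInc-intro x₃ x₁ refl p₃∈M (≢-sym M≢L) (≢-sym p₁≢p₃)))
    }
    where
    p₁∉L : ¬ Inc Γ p₁ L
    p₁∉L p₁∈L = M≢L (line-unique p₁≢p₃ p₁∈M p₃∈M p₁∈L p₃∈L)
    p₂∉M : ¬ Inc Γ p₂ M
    p₂∉M p₂∈M = M≢L (line-unique p₂≢p₃ p₂∈M p₃∈M p₂∈L p₃∈L)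
    p₁≢p₂ : p₁ ≢ p₂
    p₁≢p₂ = point-∉∈⇒≢ p₁∉L p₂∈L
    N : Fin n
    N = join p₁≢p₂
    M≢N : M ≢ N
    M≢N = ≢-sym (line-∈∉⇒≢ (join-incʳ p₁≢p₂) p₂∉M)
    N≢L : N ≢ L
    N≢L = line-∈∉⇒≢ (join-incˡ p₁≢p₂) p₁∉L
    x₁ x₂ x₃ : Elem Γ
    x₁ = elem p₁ M zero p₁∈M
    x₂ = elem p₂ N (suc zero) (join-incʳ p₁≢p₂)
    x₃ = elem p₃ L (suc (suc zero)) p₃∈L

  chamber-on-line : ∀ L → ∃[ C ] ln (c₃ C) ≡ L
  chamber-on-line L =
    let (p₂ , p₃ , p₂≢p₃ , p₂∈L , p₃∈L) = line-two-points L
        (M , p₃∈M , M≢L) = other-line p₃ L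
        (p₁ , p₁∈M , p₁≢p₃) = other-point M p₃
    in triangle-chamber p₂≢p₃ p₂∈L p₃∈L p₃∈M M≢L p₁∈M p₁≢p₃ , refl

  pointsOn-constant : FlagTransitive Γ → ∀ L L′ → pointsOn Γ L ≡ pointsOn Γ L′
  pointsOn-constant FT L L′ with chamber-on-line L | chamber-on-line L′
  ... | C , refl | D , refl = pointsOn-chamber-≡ FT C D

  two≤pointsOn : ∀ L → 2 ℕ.≤ pointsOn Γ L
  two≤pointsOn L with line-two-points L
  ... | p , q , p≢q , p∈L , q∈L =
    injective⇒≤ (Injection.injective (↔⇒↣ (↔-sym (filterᵇ-allFin-↔ _)) ↣-∘ mk↣ pick-injective))
    where
    pick : Fin 2 → PointsOn L
    pick zero = p , p∈L
    pick (suc _) = q , q∈L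
    pick-injective : Injective _≡_ _≡_ pick
    pick-injective {zero} {zero} _ = refl
    pick-injective {suc zero} {suc zero} _ = refl
    pick-injective {zero} {suc zero} e = ⊥-elim (p≢q (cong proj₁ e))
    pick-injective {suc zero} {zero} e = ⊥-elim (p≢q (cong proj₁ (sym e)))

  PointsOnLinesThrough : Fin m → Set
  PointsOnLinesThrough p = Σ (LinesThrough p) (PointsOn ∘ proj₁)

  pointsOnLinesThrough-≡ : ∀ {p} {s t : PointsOnLinesThrough p} → proj₁ (proj₁ s) ≡ proj₁ (proj₁ t) → proj₁ (proj₂ s) ≡ proj₁ (proj₂ t) → s ≡ t
  pointsOnLinesThrough-≡ {s = (L , _) , q , _} {(.L , _) , .q , _} refl refl =
    cong₂ (λ p∈L q∈L → (L , p∈L) , q , q∈L) (≡true-irrelevant _ _) (≡true-irrelevant _ _)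

  pointsOnLinesThrough-↔ : ∀ p → (PointsOnLinesThrough p ⊎ ⊤) ↔ (LinesThrough p ⊎ Fin m)
  pointsOnLinesThrough-↔ p = mk↔ₛ′ to from to-from from-to
    where
    to : PointsOnLinesThrough p ⊎ ⊤ → LinesThrough p ⊎ Fin m
    to (inj₁ (ℓ , q , _)) with q ≟ p
    ... | yes _ = inj₁ ℓ
    ... | no _  = inj₂ q
    to (inj₂ _) = inj₂ p

    from : LinesThrough p ⊎ Fin m → PointsOnLinesThrough p ⊎ ⊤
    from (inj₁ (L , p∈L)) = inj₁ ((L , p∈L) , p , p∈L)
    from (inj₂ q) with q ≟ p
    ... | yes _  = inj₂ tt
    ... | no q≢p = inj₁ ((join (≢-sym q≢p) , join-incˡ _) , q , join-incʳ _)

    to-from : ∀ y → to (from y) ≡ y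
    to-from (inj₁ _) rewrite dec-yes-irr (p ≟ p) Fin-≡-irrelevant refl = refl
    to-from (inj₂ q) with q ≟ p
    ... | yes refl = refl
    ... | no q≢p rewrite dec-no (q ≟ p) q≢p = refl

    from-to : ∀ x → from (to x) ≡ x
    from-to (inj₂ _) rewrite dec-yes-irr (p ≟ p) Fin-≡-irrelevant refl = refl
    from-to (inj₁ ((L , p∈L) , q , q∈L)) with q ≟ p
    ... | yes refl = cong inj₁ (pointsOnLinesThrough-≡ refl refl)
    ... | no q≢p rewrite dec-no (q ≟ p) q≢p =
      cong inj₁ (pointsOnLinesThrough-≡ (line-unique (≢-sym q≢p) (join-incˡ _) (join-incʳ _) p∈L q∈L) refl)

  linesThrough-equation : ∀ {k} → (∀ L → pointsOn Γ L ≡ k) →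
                          ∀ p → linesThrough Γ p ℕ.* k ℕ.+ 1 ≡ linesThrough Γ p ℕ.+ m
  linesThrough-equation {k} k-points p = ↔⇒≡ (begin
    Fin (r ℕ.* k ℕ.+ 1)           ↔⟨ +↔⊎ ⟩
    (Fin (r ℕ.* k) ⊎ Fin 1)        ↔⟨ *↔× ⊎-↔ 1↔⊤ ⟩
    ((Fin r × Fin k) ⊎ ⊤)          ↔⟨ Σ-↔ lines (points _) ⊎-↔ ↔-refl ⟩
    (PointsOnLinesThrough p ⊎ ⊤)   ↔⟨ pointsOnLinesThrough-↔ p ⟩
    (LinesThrough p ⊎ Fin m)       ↔⟨ ↔-sym lines ⊎-↔ ↔-refl ⟩
    (Fin r ⊎ Fin m)                ↔⟨ ↔-sym +↔⊎ ⟩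
    Fin (r ℕ.+ m)                  ∎)
    where
    open EquationalReasoning
    r : ℕ
    r = linesThrough Γ p
    lines : Fin r ↔ LinesThrough p
    lines = filterᵇ-allFin-↔ (λ L → I p L)
    points : ∀ L → Fin k ↔ PointsOn L
    points L = subst (λ j → Fin j ↔ PointsOn L) (k-points L) (filterᵇ-allFin-↔ (λ q → I q L))

  linesThrough-constant : FlagTransitive Γ → ∀ p p′ → linesThrough Γ p ≡ linesThrough Γ p′
  linesThrough-constant FT p p′ =
    let (L , _) = point-two-lines p
        k-points = λ L′ → pointsOn-constant FT L′ L
    in *k+1≡+m-unique (two≤pointsOn L) (linesThrough-equation k-points p) (linesThrough-equation k-points p′)

lemma3p5 : (Γ : FiniteGeometry) → IsLinearSpace Γ → FlagTransitive Γ →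
    (∃[ k ] (∀ L → pointsOn Γ L ≡ k)) × (∃[ r ] (∀ p → linesThrough Γ p ≡ r))
lemma3p5 Γ LS FT = constant⇒∃ (pointsOn-constant FT) , constant⇒∃ (linesThrough-constant FT)
  where open LinearSpace LS
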